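{- For every $k\in\mathbb{N}$, $|A_k| = |B_k| = \left(\tfrac{3}{2}k+1\right)\cdot 2^k = O(k2^k)$.
   Context: For $A=\langle a_0,\dots,a_{n-1}\rangle$ let $\mathrm{inflate}(A)=\langle 2a_0-1,2a_0,\dots,2a_{n-1}-1,2a_{n-1}\rangle$; $\circ$ denotes concatenation. Sequences $A_k=\alpha_k^0\alpha_k^1\cdots\alpha_k^{2^k-1}$ and $B_k=\beta_k^0\cdots\beta_k^{2^k-1}$ (each a concatenation of $2^k$ blocks) are defined inductively: $A_0=B_0=\langle 1\rangle$ (a single block). Given $A_k,B_k$, let $s_k$ be the largest element occurring in them (one has $s_k=2^{k+2}-3$), and for $i\in\{0,\dots,2^k-1\}$ set $\alpha_{k+1}^{2i}=\mathrm{inflate}(\alpha_k^i)\circ\langle 2s_k+2\rangle$, $\alpha_{k+1}^{2i+1}=\langle 2s_k+1,2s_k+3\rangle$, $\beta_{k+1}^{2i}=\mathrm{inflate}(\beta_k^i)\circ\langle 2s_k+1\rangle$, $\beta_{k+1}^{2i+1}=\langle 2s_k+2,2s_k+3\rangle$. -}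

module Defs where

open import Data.Nat using (ℕ; zero; suc; _+_; _*_; _∸_; _⊔_)
open import Data.List using (List; []; _∷_; _++_; concat; concatMap; map; foldr)

-- A sequence is a list of naturals; A_k and B_k are lists of 2^k blocks.
Seq : Set
Seq = List ℕ

Blocks : Set
Blocks = List Seq

inflate : Seq → Seq
inflate = concatMap (λ a → (2 * a ∸ 1) ∷ (2 * a) ∷ [])

maxSeq : Seq → ℕ
maxSeq = foldr _⊔_ 0

largest : Blocks → Blocks → ℕ
largest as bs = maxSeq (concat as) ⊔ maxSeq (concat bs)

stepA : ℕ → Blocks → Blocks
stepA s [] = []
stepA s (α ∷ αs) =
  (inflate α ++ (2 * s + 2) ∷ []) ∷ ((2 * s + 1) ∷ (2 * s + 3) ∷ []) ∷ stepA s αs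

stepB : ℕ → Blocks → Blocks
stepB s [] = []
stepB s (β ∷ βs) =
  (inflate β ++ (2 * s + 1) ∷ []) ∷ ((2 * s + 2) ∷ (2 * s + 3) ∷ []) ∷ stepB s βs

data Pair : Set where
  _,_ : Blocks → Blocks → Pair

AB : ℕ → Pair
AB zero = ((1 ∷ []) ∷ []) , ((1 ∷ []) ∷ [])
AB (suc k) with AB k
... | as , bs = stepA (largest as bs) as , stepB (largest as bs) bs

blocksA : ℕ → Blocks
blocksA k with AB k
... | as , _ = as

blocksB : ℕ → Blocks
blocksB k with AB k
... | _ , bs = bs

A : ℕ → Seq
A k = concat (blocksA k)

B : ℕ → Seq
B k = concat (blocksB k)

-- Each block α of generation k becomes two blocks of total length 2|α| + 3, so the number
-- of blocks n_k and the total length L_k of either sequence obey n_{k+1} = 2 n_k and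
-- L_{k+1} = 2 L_k + 3 n_k with n_0 = L_0 = 1, whose solution is n_k = 2^k and
-- 2 L_k = (3k + 2) 2^k.
module Submission where

open import Defs
open import Data.Nat using (ℕ; zero; suc; _+_; _*_; _^_)
open import Data.Nat.Properties using (*-suc)
open import Data.Nat.Tactic.RingSolver using (solve-∀)
open import Data.List using ([]; _∷_; _++_; length; concat)
open import Data.List.Properties using (length-++)
open import Data.Product using (_×_; _,_)
open import Function using (_∘_)
open import Relation.Binary.PropositionalEquality using (_≡_; refl; cong; cong₂; sym; trans; module ≡-Reasoning)

open ≡-Reasoning

doubling-closed-form : (n : ℕ → ℕ) → n 0 ≡ 1 → (∀ k → n (suc k) ≡ 2 * n k) →
                       ∀ k → n k ≡ 2 ^ k
doubling-closed-form n n₀ nₛ zero    = n₀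
doubling-closed-form n n₀ nₛ (suc k) = begin
  n (suc k)   ≡⟨ nₛ k ⟩
  2 * n k     ≡⟨ cong (2 *_) (doubling-closed-form n n₀ nₛ k) ⟩
  2 * 2 ^ k   ∎

recurrence-closed-form : (n L : ℕ → ℕ) → n 0 ≡ 1 → L 0 ≡ 1 →
                         (∀ k → n (suc k) ≡ 2 * n k) →
                         (∀ k → L (suc k) ≡ 2 * L k + 3 * n k) →
                         ∀ k → 2 * L k ≡ (3 * k + 2) * 2 ^ k
recurrence-closed-form n L n₀ L₀ nₛ Lₛ zero    = cong (2 *_) L₀
recurrence-closed-form n L n₀ L₀ nₛ Lₛ (suc k) = begin
  2 * L (suc k)                        ≡⟨ cong (2 *_) (Lₛ k) ⟩
  2 * (2 * L k + 3 * n k)              ≡⟨ cong (λ m → 2 * (2 * L k + 3 * m)) (doubling-closed-form n n₀ nₛ k) ⟩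
  2 * (2 * L k + 3 * 2 ^ k)            ≡⟨ distrib (L k) (2 ^ k) ⟩
  2 * (2 * L k) + 6 * 2 ^ k            ≡⟨ cong (λ m → 2 * m + 6 * 2 ^ k) (recurrence-closed-form n L n₀ L₀ nₛ Lₛ k) ⟩
  2 * ((3 * k + 2) * 2 ^ k) + 6 * 2 ^ k ≡⟨ regroup k (2 ^ k) ⟩
  (3 * suc k + 2) * 2 ^ suc k          ∎
  where
  distrib : ∀ l p → 2 * (2 * l + 3 * p) ≡ 2 * (2 * l) + 6 * p
  distrib = solve-∀
  regroup : ∀ k p → 2 * ((3 * k + 2) * p) + 6 * p ≡ (3 * suc k + 2) * (2 * p)
  regroup = solve-∀

length-inflate : ∀ α → length (inflate α) ≡ 2 * length α
length-inflate []      = refl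
length-inflate (_ ∷ α) = begin
  suc (suc (length (inflate α))) ≡⟨ cong (λ m → suc (suc m)) (length-inflate α) ⟩
  suc (suc (2 * length α))       ≡⟨ sym (*-suc 2 (length α)) ⟩
  2 * suc (length α)             ∎

length-concat-split : (α : Seq) (αs : Blocks) (x y z : ℕ) (rest : Seq) →
  length rest ≡ 2 * length (concat αs) + 3 * length αs →
  length ((inflate α ++ x ∷ []) ++ y ∷ z ∷ rest) ≡ 2 * length (concat (α ∷ αs)) + 3 * length (α ∷ αs)
length-concat-split α αs x y z rest eq = begin
  length ((inflate α ++ x ∷ []) ++ y ∷ z ∷ rest)
    ≡⟨ length-++ (inflate α ++ x ∷ []) ⟩
  length (inflate α ++ x ∷ []) + (2 + length rest)
    ≡⟨ cong (_+ (2 + length rest)) (length-++ (inflate α)) ⟩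
  length (inflate α) + 1 + (2 + length rest)
    ≡⟨ cong₂ (λ m r → m + 1 + (2 + r)) (length-inflate α) eq ⟩
  2 * length α + 1 + (2 + (2 * length (concat αs) + 3 * length αs))
    ≡⟨ regroup (length α) (length (concat αs)) (length αs) ⟩
  2 * (length α + length (concat αs)) + 3 * suc (length αs)
    ≡⟨ cong (λ m → 2 * m + 3 * suc (length αs)) (sym (length-++ α)) ⟩
  2 * length (concat (α ∷ αs)) + 3 * length (α ∷ αs) ∎
  where
  regroup : ∀ a c l → 2 * a + 1 + (2 + (2 * c + 3 * l)) ≡ 2 * (a + c) + 3 * suc l
  regroup = solve-∀

length-stepA : ∀ s αs → length (stepA s αs) ≡ 2 * length αs
length-stepA s []       = refl
length-stepA s (α ∷ αs) = begin
  suc (suc (length (stepA s αs))) ≡⟨ cong (λ m → suc (suc m)) (length-stepA s αs) ⟩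
  suc (suc (2 * length αs))       ≡⟨ sym (*-suc 2 (length αs)) ⟩
  2 * suc (length αs)             ∎

length-stepB : ∀ s βs → length (stepB s βs) ≡ 2 * length βs
length-stepB s []       = refl
length-stepB s (β ∷ βs) = begin
  suc (suc (length (stepB s βs))) ≡⟨ cong (λ m → suc (suc m)) (length-stepB s βs) ⟩
  suc (suc (2 * length βs))       ≡⟨ sym (*-suc 2 (length βs)) ⟩
  2 * suc (length βs)             ∎

length-concat-stepA : ∀ s αs → length (concat (stepA s αs)) ≡ 2 * length (concat αs) + 3 * length αs
length-concat-stepA s []       = refl
length-concat-stepA s (α ∷ αs) =
  length-concat-split α αs _ _ _ (concat (stepA s αs)) (length-concat-stepA s αs)

length-concat-stepB : ∀ s βs → length (concat (stepB s βs)) ≡ 2 * length (concat βs) + 3 * length βs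
length-concat-stepB s []       = refl
length-concat-stepB s (β ∷ βs) =
  length-concat-split β βs _ _ _ (concat (stepB s βs)) (length-concat-stepB s βs)

largest-blocks : ℕ → ℕ
largest-blocks k = largest (blocksA k) (blocksB k)

blocksA-suc : ∀ k → blocksA (suc k) ≡ stepA (largest-blocks k) (blocksA k)
blocksA-suc k with AB k
... | as , bs = refl

blocksB-suc : ∀ k → blocksB (suc k) ≡ stepB (largest-blocks k) (blocksB k)
blocksB-suc k with AB k
... | as , bs = refl

length-blocksA-suc : ∀ k → length (blocksA (suc k)) ≡ 2 * length (blocksA k)
length-blocksA-suc k = trans (cong length (blocksA-suc k)) (length-stepA (largest-blocks k) (blocksA k))

length-blocksB-suc : ∀ k → length (blocksB (suc k)) ≡ 2 * length (blocksB k)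
length-blocksB-suc k = trans (cong length (blocksB-suc k)) (length-stepB (largest-blocks k) (blocksB k))

length-A-suc : ∀ k → length (A (suc k)) ≡ 2 * length (A k) + 3 * length (blocksA k)
length-A-suc k = trans (cong (length ∘ concat) (blocksA-suc k)) (length-concat-stepA (largest-blocks k) (blocksA k))

length-B-suc : ∀ k → length (B (suc k)) ≡ 2 * length (B k) + 3 * length (blocksB k)
length-B-suc k = trans (cong (length ∘ concat) (blocksB-suc k)) (length-concat-stepB (largest-blocks k) (blocksB k))

lemma13 : (k : ℕ) → (2 * length (A k) ≡ (3 * k + 2) * 2 ^ k) × (2 * length (B k) ≡ (3 * k + 2) * 2 ^ k)
lemma13 k = recurrence-closed-form (length ∘ blocksA) (length ∘ A) refl refl length-blocksA-suc length-A-suc k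
          , recurrence-closed-form (length ∘ blocksB) (length ∘ B) refl refl length-blocksB-suc length-B-suc k
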